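{- Let $f(X)\in\mathbb{F}_2[[X]]$ be a formal power series with coefficients in $\mathbb{F}_2$. Suppose there exist a polynomial $P(X)\in\mathbb{F}_2[X]$ and an integer $r\ge 1$ such that $$f(X)=\frac{P(X)}{1+X+X^r}\qquad\text{or}\qquad f(X)=\frac{P(X)}{X^r(1+X)+1}.$$ Then for every integer $l\ge 1$ there exist a polynomial $P_l(X)\in\mathbb{F}_2[X]$ and an integer $r_l\ge 1$ such that either $$f(X)=\frac{P_l(X)}{(1+X)^l+X^{r_l}}\qquad\text{or}\qquad f(X)=\frac{P_l(X)}{X^{r_l}(1+X)^l+1}.$$
   Context: An equality $f=P/D$ with $P,D\in\mathbb{F}_2[X]$ means $D(X)f(X)=P(X)$ in $\mathbb{F}_2[[X]]$. -}

module Defs where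

open import Data.Bool using (Bool; true; false; _∧_; _xor_)
open import Data.Nat using (ℕ; zero; suc)
open import Data.List using (List; []; _∷_; replicate; map; _++_)
open import Relation.Binary.PropositionalEquality using (_≡_)

-- The field F₂ is modelled by Bool (addition = xor, multiplication = ∧).

Series : Set
Series = ℕ → Bool

-- Polynomials over F₂: coefficient lists, lowest degree first
-- (trailing zeros allowed; they do not change the polynomial).
Poly : Set
Poly = List Bool

coeff : Poly → ℕ → Bool
coeff []       _       = false
coeff (a ∷ _)  zero    = a
coeff (_ ∷ p)  (suc n) = coeff p n

_⊕_ : Poly → Poly → Poly
[]      ⊕ q       = q
p       ⊕ []      = p
(a ∷ p) ⊕ (b ∷ q) = (a xor b) ∷ (p ⊕ q)

_⊗_ : Poly → Poly → Poly
[]      ⊗ q = []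
(a ∷ p) ⊗ q = map (a ∧_) q ⊕ (false ∷ (p ⊗ q))

one : Poly
one = true ∷ []

Xpow : ℕ → Poly
Xpow r = replicate r false ++ (true ∷ [])

onePlusX : Poly
onePlusX = true ∷ true ∷ []

_^ᵖ_ : Poly → ℕ → Poly
p ^ᵖ zero  = one
p ^ᵖ suc l = p ⊗ (p ^ᵖ l)

sumTo : ℕ → (ℕ → Bool) → Bool
sumTo zero    g = g zero
sumTo (suc n) g = sumTo n g xor g (suc n)

mulCoeff : Poly → Series → ℕ → Bool
mulCoeff D f n = sumTo n (λ i → coeff D i ∧ f (n Data.Nat.∸ i))

-- f = P / D  means  D(X) f(X) = P(X) in F₂[[X]].
IsQuot : Series → Poly → Poly → Set
IsQuot f P D = ∀ n → mulCoeff D f n ≡ coeff P n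

-- In characteristic 2, a^(l+1) + b^(l+1) = a (a^l + b^l) + b^l (a + b), so by induction
-- a + b divides a^l + b^l.  Multiplying numerator and denominator of f = P / (a + b) by the
-- cofactor gives f = Pₗ / (a^l + b^l); take a = 1 + X, b = X^r, resp. a = X^r (1 + X), b = 1.
module Submission where

open import Defs
open import Data.Nat using (ℕ; _≥_)
open import Data.Product using (_×_; ∃-syntax)
open import Data.Sum using (_⊎_)

open import Algebra.Bundles using (CommutativeSemiring; CommutativeMonoid; CommutativeRing)
open import Algebra.Structures using (IsCommutativeMonoid)
import Algebra.Definitions.RawMagma as RawMagma
import Algebra.Properties.CommutativeSemigroup as CommutativeSemigroupProperties
import Algebra.Properties.CommutativeSemiring.Exp as Exp
import Algebra.Structures.Biased as Biased
open import Data.Bool using (Bool; true; false; _∧_; _xor_)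
open import Data.Bool.Properties
  using (xor-assoc; xor-comm; xor-same; xor-identityʳ; ∧-comm; ∧-assoc; ∧-zeroʳ;
         ∧-distribˡ-xor; ∧-distribʳ-xor; xor-∧-commutativeRing)
open import Data.List using ([]; _∷_; map)
open import Data.Nat using (zero; suc; _∸_)
import Data.Nat as ℕ
open import Data.Nat.Properties using (*-mono-≤)
open import Data.Product using (_,_)
open import Data.Sum using (inj₁; inj₂)
open import Level using (0ℓ)
open import Relation.Binary using (IsEquivalence; Setoid)
open import Relation.Binary.PropositionalEquality
  using (_≡_; refl; sym; trans; cong; cong₂; _≗_; module ≡-Reasoning)
import Relation.Binary.Reasoning.Setoid

module CharacteristicTwo {c ℓ} (R : CommutativeSemiring c ℓ) where
  open CommutativeSemiring R hiding (refl; sym; trans)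
  open Exp R using (_^_)
  open RawMagma *-rawMagma using (_∣_; _,_)
  open Relation.Binary.Reasoning.Setoid setoid

  module _ (x+x≈0 : ∀ x → x + x ≈ 0#) where

    +-insert : ∀ x y z → x + y ≈ (x + z) + (z + y)
    +-insert x y z = begin
      x + y              ≈⟨ +-congˡ (+-identityˡ y) ⟨
      x + (0# + y)       ≈⟨ +-congˡ (+-congʳ (x+x≈0 z)) ⟨
      x + ((z + z) + y)  ≈⟨ +-congˡ (+-assoc z z y) ⟩
      x + (z + (z + y))  ≈⟨ +-assoc x z (z + y) ⟨
      (x + z) + (z + y)  ∎

    ^-suc-+ : ∀ a b l → a ^ suc l + b ^ suc l ≈ a * (a ^ l + b ^ l) + b ^ l * (a + b)
    ^-suc-+ a b l = begin
      a * a ^ l + b * b ^ l                              ≈⟨ +-insert _ _ (a * b ^ l) ⟩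
      (a * a ^ l + a * b ^ l) + (a * b ^ l + b * b ^ l)  ≈⟨ +-cong (distribˡ a _ _) (+-cong (*-comm (b ^ l) a) (*-comm (b ^ l) b)) ⟨
      a * (a ^ l + b ^ l) + (b ^ l * a + b ^ l * b)      ≈⟨ +-congˡ (distribˡ (b ^ l) a b) ⟨
      a * (a ^ l + b ^ l) + b ^ l * (a + b)              ∎

    +∣^+^ : ∀ a b l → (a + b) ∣ (a ^ l + b ^ l)
    +∣^+^ a b zero = 0# , (begin
      0# * (a + b)  ≈⟨ zeroˡ (a + b) ⟩
      0#            ≈⟨ x+x≈0 1# ⟨
      1# + 1#       ∎)
    +∣^+^ a b (suc l) with +∣^+^ a b l
    ... | q , q[a+b]≈a^l+b^l = a * q + b ^ l , (begin
      (a * q + b ^ l) * (a + b)              ≈⟨ distribʳ (a + b) (a * q) (b ^ l) ⟩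
      a * q * (a + b) + b ^ l * (a + b)      ≈⟨ +-congʳ (*-assoc a q (a + b)) ⟩
      a * (q * (a + b)) + b ^ l * (a + b)    ≈⟨ +-congʳ (*-congˡ q[a+b]≈a^l+b^l) ⟩
      a * (a ^ l + b ^ l) + b ^ l * (a + b)  ≈⟨ ^-suc-+ a b l ⟨
      a ^ suc l + b ^ suc l                  ∎)

-- A record rather than coeff p ≗ coeff q, so that p and q are inferable from a proof.
infix 4 _≈_
record _≈_ (p q : Poly) : Set where
  constructor coeffwise
  field coeff-≡ : ∀ n → coeff p n ≡ coeff q n
open _≈_

≈-isEquivalence : IsEquivalence _≈_
≈-isEquivalence = record
  { refl  = coeffwise λ _ → refl
  ; sym   = λ p≈q → coeffwise λ n → sym (coeff-≡ p≈q n)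
  ; trans = λ p≈q q≈r → coeffwise λ n → trans (coeff-≡ p≈q n) (coeff-≡ q≈r n)
  }

≈-setoid : Setoid 0ℓ 0ℓ
≈-setoid = record { isEquivalence = ≈-isEquivalence }

open IsEquivalence ≈-isEquivalence using () renaming (refl to ≈-refl; sym to ≈-sym; trans to ≈-trans)

∷-cong : ∀ {a b p q} → a ≡ b → p ≈ q → (a ∷ p) ≈ (b ∷ q)
∷-cong a≡b p≈q = coeffwise λ { zero → a≡b ; (suc n) → coeff-≡ p≈q n }

false∷[]≈[] : (false ∷ []) ≈ []
false∷[]≈[] = coeffwise λ { zero → refl ; (suc _) → refl }

coeff-⊕ : ∀ p q n → coeff (p ⊕ q) n ≡ coeff p n xor coeff q n
coeff-⊕ []      q       n       = refl
coeff-⊕ (a ∷ p) []      n       = sym (xor-identityʳ _)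
coeff-⊕ (a ∷ p) (b ∷ q) zero    = refl
coeff-⊕ (a ∷ p) (b ∷ q) (suc n) = coeff-⊕ p q n

coeff-map : ∀ a p n → coeff (map (a ∧_) p) n ≡ a ∧ coeff p n
coeff-map a []      n       = sym (∧-zeroʳ a)
coeff-map a (b ∷ p) zero    = refl
coeff-map a (b ∷ p) (suc n) = coeff-map a p n

⊕-cong : ∀ {p p′ q q′} → p ≈ p′ → q ≈ q′ → (p ⊕ q) ≈ (p′ ⊕ q′)
⊕-cong {p} {p′} {q} {q′} p≈p′ q≈q′ = coeffwise λ n → begin
  coeff (p ⊕ q) n           ≡⟨ coeff-⊕ p q n ⟩
  coeff p n xor coeff q n   ≡⟨ cong₂ _xor_ (coeff-≡ p≈p′ n) (coeff-≡ q≈q′ n) ⟩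
  coeff p′ n xor coeff q′ n ≡⟨ coeff-⊕ p′ q′ n ⟨
  coeff (p′ ⊕ q′) n         ∎
  where open ≡-Reasoning

⊕-assoc : ∀ p q r → ((p ⊕ q) ⊕ r) ≈ (p ⊕ (q ⊕ r))
⊕-assoc p q r = coeffwise λ n → begin
  coeff ((p ⊕ q) ⊕ r) n                      ≡⟨ trans (coeff-⊕ (p ⊕ q) r n) (cong (_xor coeff r n) (coeff-⊕ p q n)) ⟩
  (coeff p n xor coeff q n) xor coeff r n    ≡⟨ xor-assoc (coeff p n) (coeff q n) (coeff r n) ⟩
  coeff p n xor (coeff q n xor coeff r n)    ≡⟨ trans (coeff-⊕ p (q ⊕ r) n) (cong (coeff p n xor_) (coeff-⊕ q r n)) ⟨
  coeff (p ⊕ (q ⊕ r)) n                      ∎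
  where open ≡-Reasoning

⊕-comm : ∀ p q → (p ⊕ q) ≈ (q ⊕ p)
⊕-comm p q = coeffwise λ n →
  trans (coeff-⊕ p q n) (trans (xor-comm (coeff p n) (coeff q n)) (sym (coeff-⊕ q p n)))

⊕-self : ∀ p → (p ⊕ p) ≈ []
⊕-self p = coeffwise λ n → trans (coeff-⊕ p p n) (xor-same (coeff p n))

⊕-isCommutativeMonoid : IsCommutativeMonoid _≈_ _⊕_ []
⊕-isCommutativeMonoid = Biased.isCommutativeMonoidˡ record
  { isSemigroup = record
    { isMagma = record { isEquivalence = ≈-isEquivalence ; ∙-cong = ⊕-cong }
    ; assoc   = ⊕-assoc
    }
  ; identityˡ = λ _ → ≈-refl
  ; comm      = ⊕-comm
  }

⊕-commutativeMonoid : CommutativeMonoid 0ℓ 0ℓ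
⊕-commutativeMonoid = record { isCommutativeMonoid = ⊕-isCommutativeMonoid }

⊕-congˡ : ∀ p {q q′} → q ≈ q′ → (p ⊕ q) ≈ (p ⊕ q′)
⊕-congˡ p = ⊕-cong (≈-refl {p})

open CommutativeSemigroupProperties (CommutativeMonoid.commutativeSemigroup ⊕-commutativeMonoid)
  using () renaming (interchange to ⊕-interchange; x∙yz≈y∙xz to ⊕-left-comm)

module ≈-Reasoning = Relation.Binary.Reasoning.Setoid ≈-setoid

map-cong : ∀ a {p q} → p ≈ q → map (a ∧_) p ≈ map (a ∧_) q
map-cong a {p} {q} p≈q = coeffwise λ n →
  trans (coeff-map a p n) (trans (cong (a ∧_) (coeff-≡ p≈q n)) (sym (coeff-map a q n)))

map-⊕ : ∀ a p q → map (a ∧_) (p ⊕ q) ≈ (map (a ∧_) p ⊕ map (a ∧_) q)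
map-⊕ a p q = coeffwise λ n → begin
  coeff (map (a ∧_) (p ⊕ q)) n                    ≡⟨ trans (coeff-map a (p ⊕ q) n) (cong (a ∧_) (coeff-⊕ p q n)) ⟩
  a ∧ (coeff p n xor coeff q n)                   ≡⟨ ∧-distribˡ-xor a (coeff p n) (coeff q n) ⟩
  (a ∧ coeff p n) xor (a ∧ coeff q n)             ≡⟨ trans (coeff-⊕ (map (a ∧_) p) _ n) (cong₂ _xor_ (coeff-map a p n) (coeff-map a q n)) ⟨
  coeff (map (a ∧_) p ⊕ map (a ∧_) q) n           ∎
  where open ≡-Reasoning

map-∧ : ∀ a b p → map ((a ∧ b) ∧_) p ≈ map (a ∧_) (map (b ∧_) p)
map-∧ a b p = coeffwise λ n → begin
  coeff (map ((a ∧ b) ∧_) p) n       ≡⟨ coeff-map (a ∧ b) p n ⟩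
  (a ∧ b) ∧ coeff p n                ≡⟨ ∧-assoc a b (coeff p n) ⟩
  a ∧ (b ∧ coeff p n)                ≡⟨ trans (coeff-map a (map (b ∧_) p) n) (cong (a ∧_) (coeff-map b p n)) ⟨
  coeff (map (a ∧_) (map (b ∧_) p)) n ∎
  where open ≡-Reasoning

⊗-congʳ : ∀ p {q q′} → q ≈ q′ → (p ⊗ q) ≈ (p ⊗ q′)
⊗-congʳ []      q≈q′ = ≈-refl
⊗-congʳ (a ∷ p) q≈q′ = ⊕-cong (map-cong a q≈q′) (∷-cong refl (⊗-congʳ p q≈q′))

⊗-zeroʳ : ∀ p → (p ⊗ []) ≈ []
⊗-zeroʳ []      = ≈-refl
⊗-zeroʳ (a ∷ p) = ≈-trans (∷-cong refl (⊗-zeroʳ p)) false∷[]≈[]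

⊗-∷ʳ : ∀ p a q → (p ⊗ (a ∷ q)) ≈ (map (a ∧_) p ⊕ (false ∷ (p ⊗ q)))
⊗-∷ʳ []      a q = ≈-sym false∷[]≈[]
⊗-∷ʳ (b ∷ p) a q = ∷-cong (cong (_xor false) (∧-comm b a))
  (≈-trans (⊕-congˡ (map (b ∧_) q) (⊗-∷ʳ p a q)) (⊕-left-comm (map (b ∧_) q) (map (a ∧_) p) _))

⊗-comm : ∀ p q → (p ⊗ q) ≈ (q ⊗ p)
⊗-comm []      q = ≈-sym (⊗-zeroʳ q)
⊗-comm (a ∷ p) q = ≈-trans (⊕-congˡ (map (a ∧_) q) (∷-cong refl (⊗-comm p q))) (≈-sym (⊗-∷ʳ q a p))

⊗-congˡ : ∀ {p p′} q → p ≈ p′ → (p ⊗ q) ≈ (p′ ⊗ q)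
⊗-congˡ {p} {p′} q p≈p′ = ≈-trans (⊗-comm p q) (≈-trans (⊗-congʳ q p≈p′) (⊗-comm q p′))

⊗-cong : ∀ {p p′ q q′} → p ≈ p′ → q ≈ q′ → (p ⊗ q) ≈ (p′ ⊗ q′)
⊗-cong {p′ = p′} {q = q} p≈p′ q≈q′ = ≈-trans (⊗-congˡ q p≈p′) (⊗-congʳ p′ q≈q′)

⊗-distribˡ : ∀ r p q → (r ⊗ (p ⊕ q)) ≈ ((r ⊗ p) ⊕ (r ⊗ q))
⊗-distribˡ []      p q = ≈-refl
⊗-distribˡ (a ∷ r) p q = ≈-trans
  (⊕-cong (map-⊕ a p q) (∷-cong refl (⊗-distribˡ r p q)))
  (⊕-interchange (map (a ∧_) p) (map (a ∧_) q) (false ∷ (r ⊗ p)) (false ∷ (r ⊗ q)))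

⊗-distribʳ : ∀ r p q → ((p ⊕ q) ⊗ r) ≈ ((p ⊗ r) ⊕ (q ⊗ r))
⊗-distribʳ r p q = ≈-trans (⊗-comm (p ⊕ q) r)
  (≈-trans (⊗-distribˡ r p q) (⊕-cong (⊗-comm r p) (⊗-comm r q)))

map-⊗ : ∀ a p q → (map (a ∧_) p ⊗ q) ≈ map (a ∧_) (p ⊗ q)
map-⊗ a []      q = ≈-refl
map-⊗ a (b ∷ p) q = ≈-trans
  (⊕-cong (map-∧ a b q) (∷-cong (sym (∧-zeroʳ a)) (map-⊗ a p q)))
  (≈-sym (map-⊕ a (map (b ∧_) q) (false ∷ (p ⊗ q))))

false∷-⊗ : ∀ p q → ((false ∷ p) ⊗ q) ≈ (false ∷ (p ⊗ q))
false∷-⊗ p q = coeffwise λ n →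
  trans (coeff-⊕ (map (false ∧_) q) _ n) (cong (_xor coeff (false ∷ (p ⊗ q)) n) (coeff-map false q n))

⊗-assoc : ∀ p q r → ((p ⊗ q) ⊗ r) ≈ (p ⊗ (q ⊗ r))
⊗-assoc []      q r = ≈-refl
⊗-assoc (a ∷ p) q r = begin
  (map (a ∧_) q ⊕ (false ∷ (p ⊗ q))) ⊗ r            ≈⟨ ⊗-distribʳ r (map (a ∧_) q) (false ∷ (p ⊗ q)) ⟩
  (map (a ∧_) q ⊗ r) ⊕ ((false ∷ (p ⊗ q)) ⊗ r)      ≈⟨ ⊕-cong (map-⊗ a q r) (false∷-⊗ (p ⊗ q) r) ⟩
  map (a ∧_) (q ⊗ r) ⊕ (false ∷ ((p ⊗ q) ⊗ r))      ≈⟨ ⊕-congˡ (map (a ∧_) (q ⊗ r)) (∷-cong refl (⊗-assoc p q r)) ⟩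
  map (a ∧_) (q ⊗ r) ⊕ (false ∷ (p ⊗ (q ⊗ r)))      ∎
  where open ≈-Reasoning

⊗-identityˡ : ∀ p → (one ⊗ p) ≈ p
⊗-identityˡ p = coeffwise λ n → begin
  coeff (map (true ∧_) p ⊕ (false ∷ [])) n               ≡⟨ coeff-⊕ (map (true ∧_) p) (false ∷ []) n ⟩
  coeff (map (true ∧_) p) n xor coeff (false ∷ []) n     ≡⟨ cong₂ _xor_ (coeff-map true p n) (coeff-≡ false∷[]≈[] n) ⟩
  coeff p n xor false                                    ≡⟨ xor-identityʳ (coeff p n) ⟩
  coeff p n                                              ∎
  where open ≡-Reasoning

Poly-commutativeSemiring : CommutativeSemiring 0ℓ 0ℓ
Poly-commutativeSemiring = record
  { _+_ = _⊕_
  ; _*_ = _⊗_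
  ; 0#  = []
  ; 1#  = one
  ; isCommutativeSemiring = Biased.isCommutativeSemiringʳ record
    { +-isCommutativeMonoid = ⊕-isCommutativeMonoid
    ; *-isCommutativeMonoid = Biased.isCommutativeMonoidˡ record
      { isSemigroup = record
        { isMagma = record { isEquivalence = ≈-isEquivalence ; ∙-cong = ⊗-cong }
        ; assoc   = ⊗-assoc
        }
      ; identityˡ = ⊗-identityˡ
      ; comm      = ⊗-comm
      }
    ; distribˡ = ⊗-distribˡ
    ; zeroʳ    = ⊗-zeroʳ
    }
  }

module Xor = CommutativeSemigroupProperties (CommutativeRing.+-commutativeSemigroup xor-∧-commutativeRing)

sumTo-cong : ∀ n {g h : ℕ → Bool} → g ≗ h → sumTo n g ≡ sumTo n h
sumTo-cong zero    g≗h = g≗h zero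
sumTo-cong (suc n) g≗h = cong₂ _xor_ (sumTo-cong n g≗h) (g≗h (suc n))

sumTo-xor : ∀ n (g h : ℕ → Bool) → sumTo n (λ i → g i xor h i) ≡ sumTo n g xor sumTo n h
sumTo-xor zero    g h = refl
sumTo-xor (suc n) g h = trans (cong (_xor (g (suc n) xor h (suc n))) (sumTo-xor n g h))
  (Xor.interchange (sumTo n g) (sumTo n h) (g (suc n)) (h (suc n)))

sumTo-∧ : ∀ n a (g : ℕ → Bool) → sumTo n (λ i → a ∧ g i) ≡ a ∧ sumTo n g
sumTo-∧ zero    a g = refl
sumTo-∧ (suc n) a g = trans (cong (_xor (a ∧ g (suc n))) (sumTo-∧ n a g))
  (sym (∧-distribˡ-xor a (sumTo n g) (g (suc n))))

sumTo-suc : ∀ n (g : ℕ → Bool) → sumTo (suc n) g ≡ g 0 xor sumTo n (λ i → g (suc i))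
sumTo-suc zero    g = refl
sumTo-suc (suc n) g = trans (cong (_xor g (suc (suc n))) (sumTo-suc n g)) (xor-assoc (g 0) _ _)

module _ (f : Series) where

  IsQuot-respʳ : ∀ P {D D′} → D ≈ D′ → IsQuot f P D → IsQuot f P D′
  IsQuot-respʳ P D≈D′ f≡P/D n =
    trans (sumTo-cong n λ i → cong (_∧ f (n ∸ i)) (sym (coeff-≡ D≈D′ i))) (f≡P/D n)

  IsQuot-⊕ : ∀ P P′ D D′ → IsQuot f P D → IsQuot f P′ D′ → IsQuot f (P ⊕ P′) (D ⊕ D′)
  IsQuot-⊕ P P′ D D′ f≡P/D f≡P′/D′ n = begin
    mulCoeff (D ⊕ D′) f n                   ≡⟨ sumTo-cong n (λ i → trans (cong (_∧ f (n ∸ i)) (coeff-⊕ D D′ i))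
                                                                     (∧-distribʳ-xor (f (n ∸ i)) (coeff D i) (coeff D′ i))) ⟩
    sumTo n (λ i → (coeff D i ∧ f (n ∸ i)) xor (coeff D′ i ∧ f (n ∸ i)))
                                            ≡⟨ sumTo-xor n _ _ ⟩
    mulCoeff D f n xor mulCoeff D′ f n      ≡⟨ cong₂ _xor_ (f≡P/D n) (f≡P′/D′ n) ⟩
    coeff P n xor coeff P′ n                ≡⟨ coeff-⊕ P P′ n ⟨
    coeff (P ⊕ P′) n                        ∎
    where open ≡-Reasoning

  IsQuot-map : ∀ a P D → IsQuot f P D → IsQuot f (map (a ∧_) P) (map (a ∧_) D)
  IsQuot-map a P D f≡P/D n = begin
    mulCoeff (map (a ∧_) D) f n           ≡⟨ sumTo-cong n (λ i → trans (cong (_∧ f (n ∸ i)) (coeff-map a D i))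
                                                                   (∧-assoc a (coeff D i) (f (n ∸ i)))) ⟩
    sumTo n (λ i → a ∧ (coeff D i ∧ f (n ∸ i)))
                                          ≡⟨ sumTo-∧ n a _ ⟩
    a ∧ mulCoeff D f n                    ≡⟨ cong (a ∧_) (f≡P/D n) ⟩
    a ∧ coeff P n                         ≡⟨ coeff-map a P n ⟨
    coeff (map (a ∧_) P) n                ∎
    where open ≡-Reasoning

  IsQuot-false∷ : ∀ P D → IsQuot f P D → IsQuot f (false ∷ P) (false ∷ D)
  IsQuot-false∷ P D f≡P/D zero    = refl
  IsQuot-false∷ P D f≡P/D (suc n) = trans (sumTo-suc n _) (f≡P/D n)

  IsQuot-⊗ : ∀ Q P D → IsQuot f P D → IsQuot f (Q ⊗ P) (Q ⊗ D)
  IsQuot-⊗ []      P D f≡P/D n = sumTo-∧ n false (λ i → f (n ∸ i))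
  IsQuot-⊗ (a ∷ Q) P D f≡P/D   =
    IsQuot-⊕ (map (a ∧_) P) (false ∷ (Q ⊗ P)) (map (a ∧_) D) (false ∷ (Q ⊗ D))
      (IsQuot-map a P D f≡P/D) (IsQuot-false∷ (Q ⊗ P) (Q ⊗ D) (IsQuot-⊗ Q P D f≡P/D))

open RawMagma (CommutativeSemiring.*-rawMagma Poly-commutativeSemiring) using (_∣_; _,_)
open CharacteristicTwo Poly-commutativeSemiring using (+∣^+^)
open Exp Poly-commutativeSemiring using (_^_; ^-congˡ; ^-assocʳ; ^-distrib-*)

IsQuot-∣ : ∀ f P D D′ → D ∣ D′ → IsQuot f P D → ∃[ P′ ] IsQuot f P′ D′
IsQuot-∣ f P D D′ (q , qD≈D′) f≡P/D = q ⊗ P , IsQuot-respʳ f (q ⊗ P) qD≈D′ (IsQuot-⊗ f q P D f≡P/D)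

IsQuot-^ : ∀ f P a b → IsQuot f P (a ⊕ b) → ∀ l → ∃[ Q ] IsQuot f Q ((a ^ l) ⊕ (b ^ l))
IsQuot-^ f P a b f≡P/[a+b] l = IsQuot-∣ f P (a ⊕ b) _ (+∣^+^ ⊕-self a b l) f≡P/[a+b]

-- _^ᵖ_ and the library's _^_ are different recursions, hence equal only up to ≈.
^ᵖ≈^ : ∀ p l → (p ^ᵖ l) ≈ (p ^ l)
^ᵖ≈^ p zero    = ≈-refl
^ᵖ≈^ p (suc l) = ⊗-congʳ p (^ᵖ≈^ p l)

one-^ : ∀ l → (one ^ l) ≈ one
one-^ zero    = ≈-refl
one-^ (suc l) = ≈-trans (⊗-identityˡ (one ^ l)) (one-^ l)

X : Poly
X = Xpow 1

X-⊗ : ∀ p → (X ⊗ p) ≈ (false ∷ p)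
X-⊗ p = ≈-trans (false∷-⊗ one p) (∷-cong refl (⊗-identityˡ p))

Xpow≈X^ : ∀ r → Xpow r ≈ (X ^ r)
Xpow≈X^ zero    = ≈-refl
Xpow≈X^ (suc r) = ≈-trans (∷-cong refl (Xpow≈X^ r)) (≈-sym (X-⊗ (X ^ r)))

Xpow-^ : ∀ r l → (Xpow r ^ l) ≈ Xpow (r ℕ.* l)
Xpow-^ r l = ≈-trans (^-congˡ l (Xpow≈X^ r)) (≈-trans (^-assocʳ X r l) (≈-sym (Xpow≈X^ (r ℕ.* l))))

theorem3 : (f : Series) →
    (∃[ P ] ∃[ r ] (r ≥ 1 × (IsQuot f P (onePlusX ⊕ Xpow r) ⊎ IsQuot f P ((Xpow r ⊗ onePlusX) ⊕ one)))) →
    ∀ (l : ℕ) → l ≥ 1 →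
    ∃[ Pₗ ] ∃[ rₗ ] (rₗ ≥ 1 × (IsQuot f Pₗ ((onePlusX ^ᵖ l) ⊕ Xpow rₗ) ⊎ IsQuot f Pₗ ((Xpow rₗ ⊗ (onePlusX ^ᵖ l)) ⊕ one)))
theorem3 f (P , r , r≥1 , inj₁ f≡P/D) l l≥1 with IsQuot-^ f P onePlusX (Xpow r) f≡P/D l
... | Q , f≡Q/Dₗ = Q , r ℕ.* l , *-mono-≤ r≥1 l≥1 ,
  inj₁ (IsQuot-respʳ f Q (⊕-cong (≈-sym (^ᵖ≈^ onePlusX l)) (Xpow-^ r l)) f≡Q/Dₗ)
theorem3 f (P , r , r≥1 , inj₂ f≡P/D) l l≥1 with IsQuot-^ f P (Xpow r ⊗ onePlusX) one f≡P/D l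
... | Q , f≡Q/Dₗ = Q , r ℕ.* l , *-mono-≤ r≥1 l≥1 ,
  inj₂ (IsQuot-respʳ f Q (⊕-cong X^r[1+X]-^ (one-^ l)) f≡Q/Dₗ)
  where
  X^r[1+X]-^ : ((Xpow r ⊗ onePlusX) ^ l) ≈ (Xpow (r ℕ.* l) ⊗ (onePlusX ^ᵖ l))
  X^r[1+X]-^ = ≈-trans (^-distrib-* (Xpow r) onePlusX l)
    (≈-trans (⊗-congˡ (onePlusX ^ l) (Xpow-^ r l)) (⊗-congʳ (Xpow (r ℕ.* l)) (≈-sym (^ᵖ≈^ onePlusX l))))
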